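{- For all integers $1\le \ell\le k$, the polynomials $M_x^n=M_x^n(t_1,\dots,t_n)$ satisfy (a) $M_{2\ell+1}^{2k+1}=M_{2\ell}^{2k}\,t_{2k+1}+M_{2\ell+1}^{2k-1}$, and (b) $M_{2\ell}^{2k+2}=M_{2\ell-1}^{2k+1}\,t_{2k+2}+M_{2\ell}^{2k}$.
   Context: For nonnegative integers $n,x$, let $A_x^n$ be the set of strictly increasing sequences $(i_1<i_2<\cdots<i_x)$ of elements of $\{1,\dots,n\}$ such that, after marking the positions $i_1,\dots,i_x$, the remaining $n-x$ positions of $\{1,\dots,n\}$ can be covered by $\frac{n-x}{2}$ disjoint 2-blocks, i.e., sets of the form $\{p,p+1\}$ (so $A_x^n=\emptyset$ if $n-x$ is odd or $x>n$, and $A_0^{2k}$ consists of the empty sequence only). For variables $t_1,t_2,\dots$, define $M_x^n=\sum_{(i_1,\dots,i_x)\in A_x^n} t_{i_1}t_{i_2}\cdots t_{i_x}$ (empty product $=1$, empty sum $=0$). -}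

module Defs where

open import Level using (Level)
open import Data.Bool using (Bool; true; false; _∧_; if_then_else_)
open import Data.Nat using (ℕ; zero; suc; _≡ᵇ_)
open import Data.List using (List; []; _∷_; _++_; map; foldr)
open import Data.Vec using (Vec; []; _∷_)
open import Algebra.Bundles using (CommutativeRing)

-- A strictly increasing sequence (i₁ < … < i_x) in {1,…,n} is encoded by
-- its set of marked positions, i.e. a vector v : Vec Bool n with
-- v[p-1] = true iff p ∈ {i₁,…,i_x}.

allMarkings : (n : ℕ) → List (Vec Bool n)
allMarkings zero = [] ∷ []
allMarkings (suc n) = map (true ∷_) (allMarkings n) ++ map (false ∷_) (allMarkings n)

marked : ∀ {n} → Vec Bool n → ℕ
marked [] = 0
marked (true ∷ v) = suc (marked v)
marked (false ∷ v) = marked v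

-- the unmarked positions can be covered by disjoint 2-blocks {p,p+1}
-- (scanning left to right, the leftmost unmarked position p must be
-- covered by the block {p,p+1}, so p+1 must also be unmarked)
coverable : ∀ {n} → Vec Bool n → Bool
coverable [] = true
coverable (true ∷ v) = coverable v
coverable (false ∷ []) = false
coverable (false ∷ true ∷ v) = false
coverable (false ∷ false ∷ v) = coverable v

inA : (x : ℕ) → ∀ {n} → Vec Bool n → Bool
inA x v = (marked v ≡ᵇ x) ∧ coverable v

module _ {c ℓ : Level} (R : CommutativeRing c ℓ) where
  open CommutativeRing R

  -- product of t_i over the marked positions i; the first entry of the
  -- vector is position (offset + 1)
  weightFrom : (t : ℕ → Carrier) (offset : ℕ) → ∀ {n} → Vec Bool n → Carrier
  weightFrom t o [] = 1#
  weightFrom t o (true ∷ v) = t (suc o) * weightFrom t (suc o) v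
  weightFrom t o (false ∷ v) = weightFrom t (suc o) v

  -- t_{i₁} ⋯ t_{i_x}, variables indexed t 1, t 2, …
  weight : (t : ℕ → Carrier) → ∀ {n} → Vec Bool n → Carrier
  weight t v = weightFrom t 0 v

  sumR : List Carrier → Carrier
  sumR = foldr _+_ 0#

  M : (t : ℕ → Carrier) (x n : ℕ) → Carrier
  M t x n = sumR (map (λ v → if inA x v then weight t v else 0#) (allMarkings n))

-- Read a marking of {1,…,n+2} from its right end.  If the last position is marked, it contributes the
-- factor t_{n+2} to a marking of {1,…,n+1} with one mark fewer.  Otherwise it lies in a 2-block with
-- position n+1, which is then unmarked as well, and what remains is a marking of {1,…,n} with the same
-- number of marks.  Both identities are instances of the resulting recurrence
-- M_{x+1}^{n+2} = M_x^{n+1} t_{n+2} + M_{x+1}^n.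
module Submission where

open import Defs
open import Level using (Level)
open import Data.Nat as ℕ using (ℕ; zero; suc; _≡ᵇ_)
import Data.Nat.Properties as ℕₚ
open import Data.Bool using (Bool; true; false; _∧_; if_then_else_)
open import Data.Bool.Properties using (∧-zeroʳ)
open import Data.List using (List; []; _∷_; _++_; map)
open import Data.List.Properties using (map-++; map-∘)
open import Data.Vec using (Vec; []; _∷_; _∷ʳ_)
open import Data.Product using (_×_; _,_)
open import Function using (_∘_)
open import Algebra.Bundles using (CommutativeRing)
import Algebra.Properties.CommutativeSemigroup as CommutativeSemigroupProperties
import Relation.Binary.PropositionalEquality as ≡
open ≡ using (_≡_)
import Relation.Binary.Reasoning.Setoid as ≈-Reasoning

marked-∷ʳ-true : ∀ {n} (v : Vec Bool n) → marked (v ∷ʳ true) ≡ suc (marked v)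
marked-∷ʳ-true []          = ≡.refl
marked-∷ʳ-true (true ∷ v)  = ≡.cong suc (marked-∷ʳ-true v)
marked-∷ʳ-true (false ∷ v) = marked-∷ʳ-true v

marked-∷ʳ-false : ∀ {n} (v : Vec Bool n) → marked (v ∷ʳ false) ≡ marked v
marked-∷ʳ-false []          = ≡.refl
marked-∷ʳ-false (true ∷ v)  = ≡.cong suc (marked-∷ʳ-false v)
marked-∷ʳ-false (false ∷ v) = marked-∷ʳ-false v

coverable-∷ʳ-true : ∀ {n} (v : Vec Bool n) → coverable (v ∷ʳ true) ≡ coverable v
coverable-∷ʳ-true []                 = ≡.refl
coverable-∷ʳ-true (true ∷ v)         = coverable-∷ʳ-true v
coverable-∷ʳ-true (false ∷ [])       = ≡.refl
coverable-∷ʳ-true (false ∷ true ∷ v) = ≡.refl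
coverable-∷ʳ-true (false ∷ false ∷ v) = coverable-∷ʳ-true v

coverable-∷ʳ-true-false : ∀ {n} (v : Vec Bool n) → coverable (v ∷ʳ true ∷ʳ false) ≡ false
coverable-∷ʳ-true-false []                  = ≡.refl
coverable-∷ʳ-true-false (true ∷ v)          = coverable-∷ʳ-true-false v
coverable-∷ʳ-true-false (false ∷ [])        = ≡.refl
coverable-∷ʳ-true-false (false ∷ true ∷ v)  = ≡.refl
coverable-∷ʳ-true-false (false ∷ false ∷ v) = coverable-∷ʳ-true-false v

coverable-∷ʳ-false-false : ∀ {n} (v : Vec Bool n) → coverable (v ∷ʳ false ∷ʳ false) ≡ coverable v
coverable-∷ʳ-false-false []                  = ≡.refl
coverable-∷ʳ-false-false (true ∷ v)          = coverable-∷ʳ-false-false v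
coverable-∷ʳ-false-false (false ∷ [])        = ≡.refl
coverable-∷ʳ-false-false (false ∷ true ∷ v)  = ≡.refl
coverable-∷ʳ-false-false (false ∷ false ∷ v) = coverable-∷ʳ-false-false v

inA-∷ʳ-true : ∀ x {n} (v : Vec Bool n) → inA (suc x) (v ∷ʳ true) ≡ inA x v
inA-∷ʳ-true x v =
  ≡.cong₂ (λ m b → (m ≡ᵇ suc x) ∧ b) (marked-∷ʳ-true v) (coverable-∷ʳ-true v)

inA-∷ʳ-true-false : ∀ x {n} (v : Vec Bool n) → inA x (v ∷ʳ true ∷ʳ false) ≡ false
inA-∷ʳ-true-false x v =
  ≡.trans (≡.cong ((marked (v ∷ʳ true ∷ʳ false) ≡ᵇ x) ∧_) (coverable-∷ʳ-true-false v)) (∧-zeroʳ _)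

inA-∷ʳ-false-false : ∀ x {n} (v : Vec Bool n) → inA x (v ∷ʳ false ∷ʳ false) ≡ inA x v
inA-∷ʳ-false-false x v =
  ≡.cong₂ (λ m b → (m ≡ᵇ x) ∧ b)
    (≡.trans (marked-∷ʳ-false (v ∷ʳ false)) (marked-∷ʳ-false v)) (coverable-∷ʳ-false-false v)

module _ {c ℓ} (R : CommutativeRing c ℓ) where
  open CommutativeRing R
  open ≈-Reasoning setoid
  open CommutativeSemigroupProperties +-commutativeSemigroup using (interchange)

  sumR-++ : (xs ys : List Carrier) → sumR R (xs ++ ys) ≈ sumR R xs + sumR R ys
  sumR-++ []       ys = sym (+-identityˡ _)
  sumR-++ (x ∷ xs) ys = trans (+-congˡ (sumR-++ xs ys)) (sym (+-assoc _ _ _))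

  sumR-cong : ∀ {a} {A : Set a} {f g : A → Carrier} → (∀ x → f x ≈ g x) →
              (xs : List A) → sumR R (map f xs) ≈ sumR R (map g xs)
  sumR-cong f≈g []       = refl
  sumR-cong f≈g (x ∷ xs) = +-cong (f≈g x) (sumR-cong f≈g xs)

  sumR-*ʳ : ∀ {a} {A : Set a} (f : A → Carrier) (y : Carrier) (xs : List A) →
            sumR R (map (λ x → f x * y) xs) ≈ sumR R (map f xs) * y
  sumR-*ʳ f y []       = sym (zeroˡ y)
  sumR-*ʳ f y (x ∷ xs) = trans (+-congˡ (sumR-*ʳ f y xs)) (sym (distribʳ y _ _))

  sumR-0# : ∀ {a} {A : Set a} (xs : List A) → sumR R (map (λ _ → 0#) xs) ≈ 0#
  sumR-0# []       = refl
  sumR-0# (x ∷ xs) = trans (+-identityˡ _) (sumR-0# xs)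

  sumMarkings : ∀ n → (Vec Bool n → Carrier) → Carrier
  sumMarkings n f = sumR R (map f (allMarkings n))

  sumMarkings-∷ : ∀ n (f : Vec Bool (suc n) → Carrier) →
    sumMarkings (suc n) f ≈ sumMarkings n (f ∘ (true ∷_)) + sumMarkings n (f ∘ (false ∷_))
  sumMarkings-∷ n f = begin
    sumR R (map f (map (true ∷_) vs ++ map (false ∷_) vs))
      ≡⟨ ≡.cong (sumR R) (map-++ f (map (true ∷_) vs) (map (false ∷_) vs)) ⟩
    sumR R (map f (map (true ∷_) vs) ++ map f (map (false ∷_) vs))
      ≈⟨ sumR-++ (map f (map (true ∷_) vs)) (map f (map (false ∷_) vs)) ⟩
    sumR R (map f (map (true ∷_) vs)) + sumR R (map f (map (false ∷_) vs))
      ≡⟨ ≡.sym (≡.cong₂ (λ xs ys → sumR R xs + sumR R ys) (map-∘ vs) (map-∘ vs)) ⟩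
    sumMarkings n (f ∘ (true ∷_)) + sumMarkings n (f ∘ (false ∷_)) ∎
    where vs = allMarkings n

  sumMarkings-∷ʳ : ∀ n (f : Vec Bool (suc n) → Carrier) →
    sumMarkings (suc n) f ≈ sumMarkings n (f ∘ (_∷ʳ true)) + sumMarkings n (f ∘ (_∷ʳ false))
  sumMarkings-∷ʳ zero    f = +-congʳ (sym (+-identityʳ _))
  sumMarkings-∷ʳ (suc n) f = begin
    sumMarkings (suc (suc n)) f
      ≈⟨ sumMarkings-∷ (suc n) f ⟩
    sumMarkings (suc n) (f ∘ (true ∷_)) + sumMarkings (suc n) (f ∘ (false ∷_))
      ≈⟨ +-cong (sumMarkings-∷ʳ n (f ∘ (true ∷_))) (sumMarkings-∷ʳ n (f ∘ (false ∷_))) ⟩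
    (Σ (λ v → f (true ∷ (v ∷ʳ true))) + Σ (λ v → f (true ∷ (v ∷ʳ false)))) +
    (Σ (λ v → f (false ∷ (v ∷ʳ true))) + Σ (λ v → f (false ∷ (v ∷ʳ false))))
      ≈⟨ interchange _ _ _ _ ⟩
    (Σ (λ v → f (true ∷ (v ∷ʳ true))) + Σ (λ v → f (false ∷ (v ∷ʳ true)))) +
    (Σ (λ v → f (true ∷ (v ∷ʳ false))) + Σ (λ v → f (false ∷ (v ∷ʳ false))))
      ≈⟨ sym (+-cong (sumMarkings-∷ n (f ∘ (_∷ʳ true))) (sumMarkings-∷ n (f ∘ (_∷ʳ false)))) ⟩
    sumMarkings (suc n) (f ∘ (_∷ʳ true)) + sumMarkings (suc n) (f ∘ (_∷ʳ false)) ∎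
    where Σ = sumMarkings n

  weightFrom-∷ʳ-true : ∀ t o {n} (v : Vec Bool n) →
    weightFrom R t o (v ∷ʳ true) ≈ weightFrom R t o v * t (suc (o ℕ.+ n))
  weightFrom-∷ʳ-true t o [] =
    trans (*-comm _ _) (*-congˡ (reflexive (≡.cong (t ∘ suc) (≡.sym (ℕₚ.+-identityʳ o)))))
  weightFrom-∷ʳ-true t o {suc n} (true ∷ v) = begin
    t (suc o) * weightFrom R t (suc o) (v ∷ʳ true)
      ≈⟨ *-congˡ (weightFrom-∷ʳ-true t (suc o) v) ⟩
    t (suc o) * (weightFrom R t (suc o) v * t (suc (suc o ℕ.+ n)))
      ≈⟨ sym (*-assoc _ _ _) ⟩
    t (suc o) * weightFrom R t (suc o) v * t (suc (suc o ℕ.+ n))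
      ≡⟨ ≡.cong (λ i → t (suc o) * weightFrom R t (suc o) v * t (suc i)) (≡.sym (ℕₚ.+-suc o n)) ⟩
    t (suc o) * weightFrom R t (suc o) v * t (suc (o ℕ.+ suc n)) ∎
  weightFrom-∷ʳ-true t o {suc n} (false ∷ v) = begin
    weightFrom R t (suc o) (v ∷ʳ true)
      ≈⟨ weightFrom-∷ʳ-true t (suc o) v ⟩
    weightFrom R t (suc o) v * t (suc (suc o ℕ.+ n))
      ≡⟨ ≡.cong (λ i → weightFrom R t (suc o) v * t (suc i)) (≡.sym (ℕₚ.+-suc o n)) ⟩
    weightFrom R t (suc o) v * t (suc (o ℕ.+ suc n)) ∎

  weightFrom-∷ʳ-false : ∀ t o {n} (v : Vec Bool n) → weightFrom R t o (v ∷ʳ false) ≡ weightFrom R t o v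
  weightFrom-∷ʳ-false t o []          = ≡.refl
  weightFrom-∷ʳ-false t o (true ∷ v)  = ≡.cong (t (suc o) *_) (weightFrom-∷ʳ-false t (suc o) v)
  weightFrom-∷ʳ-false t o (false ∷ v) = weightFrom-∷ʳ-false t (suc o) v

  summand : (ℕ → Carrier) → ℕ → ∀ {n} → Vec Bool n → Carrier
  summand t x v = if inA x v then weight R t v else 0#

  if-then-*ʳ : ∀ b {y z} w → y ≈ z * w → (if b then y else 0#) ≈ (if b then z else 0#) * w
  if-then-*ʳ true  w y≈z*w = y≈z*w
  if-then-*ʳ false w _     = sym (zeroˡ w)

  summand-∷ʳ-true : ∀ t x {n} (v : Vec Bool n) → summand t (suc x) (v ∷ʳ true) ≈ summand t x v * t (suc n)
  summand-∷ʳ-true t x v =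
    trans (reflexive (≡.cong (λ b → if b then weight R t (v ∷ʳ true) else 0#) (inA-∷ʳ-true x v)))
          (if-then-*ʳ (inA x v) _ (weightFrom-∷ʳ-true t 0 v))

  summand-∷ʳ-true-false : ∀ t x {n} (v : Vec Bool n) → summand t x (v ∷ʳ true ∷ʳ false) ≡ 0#
  summand-∷ʳ-true-false t x v = ≡.cong (λ b → if b then _ else 0#) (inA-∷ʳ-true-false x v)

  summand-∷ʳ-false-false : ∀ t x {n} (v : Vec Bool n) → summand t x (v ∷ʳ false ∷ʳ false) ≡ summand t x v
  summand-∷ʳ-false-false t x v =
    ≡.cong₂ (λ b w → if b then w else 0#) (inA-∷ʳ-false-false x v)
      (≡.trans (weightFrom-∷ʳ-false t 0 (v ∷ʳ false)) (weightFrom-∷ʳ-false t 0 v))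

  M-last : ∀ t x m → M R t (suc x) (suc (suc m)) ≈ M R t x (suc m) * t (suc (suc m)) + M R t (suc x) m
  M-last t x m = begin
    M R t (suc x) (suc (suc m))
      ≈⟨ sumMarkings-∷ʳ (suc m) (summand t (suc x)) ⟩
    sumMarkings (suc m) (λ v → summand t (suc x) (v ∷ʳ true)) +
    sumMarkings (suc m) (λ v → summand t (suc x) (v ∷ʳ false))
      ≈⟨ +-cong lastMarked lastUnmarked ⟩
    M R t x (suc m) * t (suc (suc m)) + M R t (suc x) m ∎
    where
    lastMarked : sumMarkings (suc m) (λ v → summand t (suc x) (v ∷ʳ true)) ≈ M R t x (suc m) * t (suc (suc m))
    lastMarked = trans (sumR-cong (summand-∷ʳ-true t x) (allMarkings (suc m)))
                       (sumR-*ʳ (summand t x) _ (allMarkings (suc m)))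

    lastUnmarked : sumMarkings (suc m) (λ v → summand t (suc x) (v ∷ʳ false)) ≈ M R t (suc x) m
    lastUnmarked = begin
      sumMarkings (suc m) (λ v → summand t (suc x) (v ∷ʳ false))
        ≈⟨ sumMarkings-∷ʳ m (λ v → summand t (suc x) (v ∷ʳ false)) ⟩
      sumMarkings m (λ v → summand t (suc x) (v ∷ʳ true ∷ʳ false)) +
      sumMarkings m (λ v → summand t (suc x) (v ∷ʳ false ∷ʳ false))
        ≈⟨ +-cong (trans (sumR-cong (reflexive ∘ summand-∷ʳ-true-false t (suc x)) (allMarkings m))
                         (sumR-0# (allMarkings m)))
                  (sumR-cong (reflexive ∘ summand-∷ʳ-false-false t (suc x)) (allMarkings m)) ⟩
      0# + M R t (suc x) m
        ≈⟨ +-identityˡ _ ⟩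
      M R t (suc x) m ∎

open import Data.Nat using (_≤_; _+_; _*_; _∸_)

-- 1 ≤ ℓ ≤ k is used only to write 2ℓ and 2k as successors.
lemma5p10 : {c ℓ' : Level} (R : CommutativeRing c ℓ') (t : ℕ → CommutativeRing.Carrier R) →
    (ℓ k : ℕ) → 1 ≤ ℓ → ℓ ≤ k →
    (CommutativeRing._≈_ R (M R t (suc (2 * ℓ)) (suc (2 * k)))
      (CommutativeRing._+_ R (CommutativeRing._*_ R (M R t (2 * ℓ) (2 * k)) (t (suc (2 * k)))) (M R t (suc (2 * ℓ)) (2 * k ∸ 1))))
    × (CommutativeRing._≈_ R (M R t (2 * ℓ) (2 + 2 * k))
      (CommutativeRing._+_ R (CommutativeRing._*_ R (M R t (2 * ℓ ∸ 1) (suc (2 * k))) (t (2 + 2 * k))) (M R t (2 * ℓ) (2 * k))))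
lemma5p10 R t (suc l) (suc k) _ _ =
  M-last R t (2 * suc l) (2 * suc k ∸ 1) , M-last R t (2 * suc l ∸ 1) (2 * suc k)
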